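{- Let $r,s\ge 2$ be integers and let $G_{r,s}$ be the $r$-partite graph with classes $A_1,\dots,A_r$ defined below, and $\widetilde{G}_{r,s}$ its $r$-partite complement with respect to $A_1,\dots,A_r$. Then: (1) $G_{r,s}$ is $r$-partite with vertex partition $A_1 \cup \cdots \cup A_r$; (2) $\widetilde{G}_{r,s}$ is $K_{r}$-free; (3) for each $i \in [r]$, there is a copy of $K_{r-1}$ in $\widetilde{G}_{r,s} \setminus A_{i}$; (4) every edge of $G_{r,s}$ between two different vertex classes is $r$-saturating in $\widetilde{G}_{r,s}$, i.e. adding it to $\widetilde{G}_{r,s}$ creates a copy of $K_r$; (5) $|G_{r,s}| = \sum_{i=1}^{r-2}s^{i} + 4s^{r-1} = \frac{s}{s-1}(4s^{r-1}-3s^{r-2}-1) \le 4\frac{s^{r}}{s-1}$; (6) $e(G_{r,s}) \leq 4(r-1)s^{r}$; (7) the two largest vertex classes have size $2s^{r-1}$; (8) all other vertex classes have size at most $s^{r-2}$; (9) there is a matching between the two largest vertex classes of $G_{r,s}$; (10) every independent set in $G_{r,s}$ has at most $|G_{r,s}| - 2s^{r-1}$ vertices.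
   Context: Construction of $G_{r,s_1,\dots,s_{r-1}}$ for integers $s_1,\dots,s_{r-1}\ge 2$: $G_{2,s_1}$ is the complete bipartite graph $K_{s_1,s_1}$ with classes $A_1,A_2$. For $2\le t\le r-1$, given the $t$-partite graph $G_{t,s_1,\dots,s_{t-1}}$, take vertex-disjoint copies $H_1,\dots,H_{s_t}$ of it, where $H_p$ has classes $A_1^p,\dots,A_t^p$; $G_{t+1,s_1,\dots,s_t}$ is the $(t+1)$-partite graph with classes $A_i = A_i^1\cup\dots\cup A_i^{s_t}$ for $i\in[t]$ and $A_{t+1}=\{x_1,\dots,x_{s_t}\}$ (new vertices), and edge set $\bigcup_{p} E(H_p)\cup\{x_p y : y\in V(H_q),\ p,q\in[s_t],\ p\ne q\}$. Then $G_{r,s}$ is defined as $G_{r,2s,s,\dots,s}$ (i.e. $s_1=2s$ and $s_i=s$ for $2\le i\le r-1$), with classes $A_1,\dots,A_r$. The $r$-partite complement of an $r$-partite graph with partition $A_1,\dots,A_r$ is the graph on the same vertex set whose edges are exactly the non-edges joining distinct classes. $|G|$ denotes the number of vertices. -}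

module Defs where

open import Data.Nat using (ℕ; zero; suc; _+_; _*_; _^_; _<ᵇ_)
open import Data.Bool using (Bool; true; false; _∧_; _∨_; not; if_then_else_)
open import Data.Fin using (Fin; zero; suc; toℕ; splitAt; remQuot; inject₁; fromℕ)
open import Data.Fin.Properties using (_≟_)
open import Data.Sum using (inj₁; inj₂)
open import Data.Product using (_×_; _,_; Σ; ∃)
open import Relation.Nullary using (¬_)
open import Relation.Nullary.Decidable using (⌊_⌋)
open import Relation.Binary.PropositionalEquality using (_≡_; _≢_)
open import Function.Definitions using (Injective)

record PGraph (r : ℕ) : Set where
  field
    n   : ℕ
    adj : Fin n → Fin n → Bool
    cls : Fin n → Fin r
open PGraph public

_==_ : ∀ {m} → Fin m → Fin m → Bool
i == j = ⌊ i ≟ j ⌋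

countF : ∀ {m} → (Fin m → Bool) → ℕ
countF {zero}  f = 0
countF {suc m} f = (if f zero then 1 else 0) + countF (λ i → f (suc i))

sumF : ∀ {m} → (Fin m → ℕ) → ℕ
sumF {zero}  f = 0
sumF {suc m} f = f zero + sumF (λ i → f (suc i))

classSize : ∀ {r} (G : PGraph r) → Fin r → ℕ
classSize G i = countF (λ v → cls G v == i)

edges : ∀ {r} (G : PGraph r) → ℕ
edges G = sumF (λ u → countF (λ v → (toℕ u <ᵇ toℕ v) ∧ adj G u v))

pComplement : ∀ {r} → PGraph r → PGraph r
pComplement G = record
  { n   = n G
  ; adj = λ u v → not (cls G u == cls G v) ∧ not (adj G u v)
  ; cls = cls G }

addEdge : ∀ {r} (G : PGraph r) → Fin (n G) → Fin (n G) → PGraph r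
addEdge G u v = record
  { n   = n G
  ; adj = λ x y → adj G x y ∨ ((x == u ∧ y == v) ∨ (x == v ∧ y == u))
  ; cls = cls G }

KCopy : ∀ {r} (m : ℕ) (G : PGraph r) → Set
KCopy m G = Σ (Fin m → Fin (n G)) λ f →
  Injective _≡_ _≡_ f × (∀ i j → i ≢ j → adj G (f i) (f j) ≡ true)

KCopyAvoiding : ∀ {r} (m : ℕ) (G : PGraph r) → Fin r → Set
KCopyAvoiding m G c = Σ (Fin m → Fin (n G)) λ f →
  Injective _≡_ _≡_ f × (∀ i j → i ≢ j → adj G (f i) (f j) ≡ true)
    × (∀ i → cls G (f i) ≢ c)

-- The construction G_{r,s} = G_{r,2s,s,...,s}, indexed by k = r - 2.
--
-- Stage k = 0 : G_{2,2s} = K_{2s,2s}; vertex set Fin (2s + 2s),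
--   first block = A_1 (class 0), second block = A_2 (class 1).
-- Stage k+1 : s copies H_1..H_s of stage k (vertices (p , u) encoded
--   by Fin (s * N k) via remQuot), followed by s new vertices
--   x_1..x_s (the new class A_{k+3}, the last class).
--   Edges: inside each copy as before; x_p ~ every vertex of H_q, q ≠ p.

Nv : ℕ → ℕ → ℕ
Nv s zero    = 2 * s + 2 * s
Nv s (suc k) = s * Nv s k + s

adjG : ∀ s k → Fin (Nv s k) → Fin (Nv s k) → Bool
adjG s zero u v with splitAt (2 * s) u | splitAt (2 * s) v
... | inj₁ _ | inj₁ _ = false
... | inj₁ _ | inj₂ _ = true
... | inj₂ _ | inj₁ _ = true
... | inj₂ _ | inj₂ _ = false
adjG s (suc k) u v with splitAt (s * Nv s k) u | splitAt (s * Nv s k) v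
... | inj₁ a | inj₁ b with remQuot {s} (Nv s k) a | remQuot {s} (Nv s k) b
...   | p , a' | q , b' = (p == q) ∧ adjG s k a' b'
adjG s (suc k) u v | inj₁ a | inj₂ x with remQuot {s} (Nv s k) a
...   | p , _ = not (p == x)
adjG s (suc k) u v | inj₂ x | inj₁ b with remQuot {s} (Nv s k) b
...   | q , _ = not (x == q)
adjG s (suc k) u v | inj₂ _ | inj₂ _ = false

clsG : ∀ s k → Fin (Nv s k) → Fin (suc (suc k))
clsG s zero u with splitAt (2 * s) u
... | inj₁ _ = zero
... | inj₂ _ = suc zero
clsG s (suc k) u with splitAt (s * Nv s k) u
... | inj₁ a with remQuot {s} (Nv s k) a
...   | _ , a' = inject₁ (clsG s k a')
clsG s (suc k) u | inj₂ _ = fromℕ (suc (suc k))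

-- G_{r,s} with r = k + 2, classes A_1..A_r = class 0 .. class (r-1)
Grs : (k s : ℕ) → PGraph (suc (suc k))
Grs k s = record { n = Nv s k ; adj = adjG s k ; cls = clsG s k }

sumPow : ℕ → ℕ → ℕ
sumPow s zero    = 0
sumPow s (suc m) = sumPow s m + s ^ suc m

-- G_{r+1,s} consists of s copies H_p of G_{r,s} and a new class of apices x_p, where
-- x_p is joined to every copy except H_p.  In the r-partite complement the apex x_p is
-- therefore adjacent exactly to H_p, so a clique containing an apex lies otherwise in
-- one copy, while a clique without an apex misses the new class; by induction there is
-- no K_r.  The same description builds the required cliques recursively: inside copy p
-- they are extended by x_p, and an edge of G from x_q to a vertex y of H_p (p ≠ q) is
-- completed by a K_{r-2} of H_q avoiding the class of y.  The two largest classes are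
-- the sides of the s^{r-2} copies of K_{2s,2s}, whose perfect matchings give the matching
-- and the bound on independent sets; the vertex and edge counts follow from the
-- recursions |G_{k+1}| = s|G_k| + s and the degree sum, which bounds 2e(G).

module Submission where

open import Defs
open import Data.Nat using (ℕ; zero; suc; _+_; _*_; _^_; _∸_; _≤_; _<ᵇ_; z≤n; s≤s; >-nonZero)
open import Data.Nat.Properties hiding (_≟_; suc-injective)
open import Data.Nat.Tactic.RingSolver using (solve-∀)
open import Data.Bool using (Bool; true; false; _∧_; _∨_; not; if_then_else_)
open import Data.Bool.Properties using (∨-comm; ∧-comm; ∨-zeroʳ; ∧-zeroʳ; ∧-identityʳ)
open import Data.Fin using (Fin; zero; suc; toℕ; inject₁; fromℕ; splitAt; remQuot; combine; quotRem; _↑ˡ_; _↑ʳ_; punchIn; punchOut)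
open import Data.Fin.Properties using (_≟_; suc-injective; inject₁-injective; fromℕ≢inject₁; toℕ-inject₁; injective⇒≤; splitAt-↑ˡ; splitAt-↑ʳ; splitAt⁻¹-↑ˡ; splitAt⁻¹-↑ʳ; remQuot-combine; combine-remQuot; combine-injective; ↑ˡ-injective; ↑ʳ-injective; punchOut-injective; punchIn-injective; punchInᵢ≢i; any?)
open import Data.Fin.Relation.Unary.Top using (‵fromℕ; ‵inject₁) renaming (view to topView)
open import Data.Fin.Subset using (Subset; _∈_; ∣_∣)
import Data.Vec as Vec
open import Data.Vec.Properties using (lookup⇒[]=)
open import Data.Vec.Functional using ([]; _∷_)
open import Data.Product using (_×_; _,_; Σ; proj₁; proj₂; uncurry; swap)
open import Data.Sum using (inj₁; inj₂; reduce; [_,_]′)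
open import Function using (_∘_)
open import Function.Definitions using (Injective)
open import Relation.Nullary using (¬_; yes; no; contradiction)
open import Relation.Nullary.Decidable using (isYes≗does; dec-true; dec-false)
open import Relation.Binary.PropositionalEquality
open import Algebra.Properties.CommutativeSemigroup *-commutativeSemigroup using (x∙yz≈y∙xz)
open import Algebra.Properties.CommutativeMonoid.Sum +-0-commutativeMonoid using (sum; ∑-distrib-+; ∑-comm)

private variable m m′ : ℕ

≡⇒== : {i j : Fin m} → i ≡ j → (i == j) ≡ true
≡⇒== {i = i} {j} i≡j = trans (isYes≗does (i ≟ j)) (dec-true (i ≟ j) i≡j)

≢⇒== : {i j : Fin m} → i ≢ j → (i == j) ≡ false
≢⇒== {i = i} {j} i≢j = trans (isYes≗does (i ≟ j)) (dec-false (i ≟ j) i≢j)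

==⇒≡ : {i j : Fin m} → (i == j) ≡ true → i ≡ j
==⇒≡ {i = i} {j} eq with i ≟ j
... | yes i≡j = i≡j
==⇒≡ {i = i} {j} () | no _

==-refl : (i : Fin m) → (i == i) ≡ true
==-refl i = ≡⇒== refl

==-sym : (i j : Fin m) → (i == j) ≡ (j == i)
==-sym i j with i ≟ j
... | yes refl = sym (==-refl i)
... | no i≢j = sym (≢⇒== (i≢j ∘ sym))

==-injective : {f : Fin m → Fin m′} → Injective _≡_ _≡_ f → (i j : Fin m) → (f i == f j) ≡ (i == j)
==-injective {f = f} f-inj i j with i ≟ j
... | yes refl = ==-refl (f i)
... | no i≢j = ≢⇒== (i≢j ∘ f-inj)

∧-true : ∀ {a b} → a ∧ b ≡ true → a ≡ true × b ≡ true
∧-true {true} b≡true = refl , b≡true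

<ᵇ-asym : ∀ a b → (a <ᵇ b) ∧ (b <ᵇ a) ≡ false
<ᵇ-asym zero zero = refl
<ᵇ-asym zero (suc b) = refl
<ᵇ-asym (suc a) zero = refl
<ᵇ-asym (suc a) (suc b) = <ᵇ-asym a b

m≤m^[1+n] : ∀ m n → m ≤ m ^ suc n
m≤m^[1+n] zero n = z≤n
m≤m^[1+n] m@(suc _) n = m≤m*n m (m ^ n) {{>-nonZero (m^n>0 m n)}}

injective-missing⇒≤ : {f : Fin m → Fin (suc m′)} (t : Fin (suc m′)) → Injective _≡_ _≡_ f → (∀ i → f i ≢ t) → m ≤ m′
injective-missing⇒≤ t f-inj misses =
  injective⇒≤ {f = λ i → punchOut (misses i ∘ sym)} (λ {i} {j} eq → f-inj (punchOut-injective (misses i ∘ sym) (misses j ∘ sym) eq))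

sumF≡sum : (f : Fin m → ℕ) → sumF f ≡ sum f
sumF≡sum {zero} f = refl
sumF≡sum {suc m} f = cong (f zero +_) (sumF≡sum (f ∘ suc))

sumF-cong : {f g : Fin m → ℕ} → (∀ i → f i ≡ g i) → sumF f ≡ sumF g
sumF-cong {zero} eq = refl
sumF-cong {suc m} eq = cong₂ _+_ (eq zero) (sumF-cong (eq ∘ suc))

sumF-mono : {f g : Fin m → ℕ} → (∀ i → f i ≤ g i) → sumF f ≤ sumF g
sumF-mono {zero} le = z≤n
sumF-mono {suc m} le = +-mono-≤ (le zero) (sumF-mono (le ∘ suc))

sumF-const : ∀ m c → sumF {m} (λ _ → c) ≡ m * c
sumF-const zero c = refl
sumF-const (suc m) c = cong (c +_) (sumF-const m c)

sumF-+ : (f g : Fin m → ℕ) → sumF (λ i → f i + g i) ≡ sumF f + sumF g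
sumF-+ f g = begin
  sumF (λ i → f i + g i)  ≡⟨ sumF≡sum (λ i → f i + g i) ⟩
  sum (λ i → f i + g i)   ≡⟨ ∑-distrib-+ f g ⟩
  sum f + sum g           ≡⟨ cong₂ _+_ (sumF≡sum f) (sumF≡sum g) ⟨
  sumF f + sumF g         ∎
  where open ≡-Reasoning

sumF-comm : (f : Fin m → Fin m′ → ℕ) → sumF (λ i → sumF (f i)) ≡ sumF (λ j → sumF (λ i → f i j))
sumF-comm f = begin
  sumF (λ i → sumF (f i))              ≡⟨ sumF-cong (λ i → sumF≡sum (f i)) ⟩
  sumF (λ i → sum (f i))               ≡⟨ sumF≡sum (λ i → sum (f i)) ⟩
  sum (λ i → sum (f i))                ≡⟨ ∑-comm f ⟩
  sum (λ j → sum (λ i → f i j))        ≡⟨ sumF≡sum (λ j → sum (λ i → f i j)) ⟨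
  sumF (λ j → sum (λ i → f i j))       ≡⟨ sumF-cong (λ j → sumF≡sum (λ i → f i j)) ⟨
  sumF (λ j → sumF (λ i → f i j))      ∎
  where open ≡-Reasoning

sumF-↑ : ∀ m {n} (f : Fin (m + n) → ℕ) → sumF f ≡ sumF (f ∘ (_↑ˡ n)) + sumF (f ∘ (m ↑ʳ_))
sumF-↑ zero f = refl
sumF-↑ (suc m) f = trans (cong (f zero +_) (sumF-↑ m (f ∘ suc))) (sym (+-assoc (f zero) _ _))

sumF-combine : ∀ m n (f : Fin (m * n) → ℕ) → sumF f ≡ sumF {m} (λ p → sumF {n} (λ a → f (combine p a)))
sumF-combine zero n f = refl
sumF-combine (suc m) n f =
  trans (sumF-↑ n f) (cong (sumF (f ∘ (_↑ˡ (m * n))) +_) (sumF-combine m n (f ∘ (n ↑ʳ_))))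

𝟙 : Bool → ℕ
𝟙 b = if b then 1 else 0

countF≡sumF : (f : Fin m → Bool) → countF f ≡ sumF (𝟙 ∘ f)
countF≡sumF {zero} f = refl
countF≡sumF {suc m} f = cong (𝟙 (f zero) +_) (countF≡sumF (f ∘ suc))

countF-cong : {f g : Fin m → Bool} → (∀ i → f i ≡ g i) → countF f ≡ countF g
countF-cong {zero} eq = refl
countF-cong {suc m} eq = cong₂ _+_ (cong 𝟙 (eq zero)) (countF-cong (eq ∘ suc))

countF-≤ : (f : Fin m → Bool) → countF f ≤ m
countF-≤ {zero} f = z≤n
countF-≤ {suc m} f with f zero
... | true = s≤s (countF-≤ (f ∘ suc))
... | false = m≤n⇒m≤1+n (countF-≤ (f ∘ suc))

countF-const : ∀ m b → countF {m} (λ _ → b) ≡ (if b then m else 0)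
countF-const zero true = refl
countF-const zero false = refl
countF-const (suc m) true = cong suc (countF-const m true)
countF-const (suc m) false = countF-const m false

countF-∧ : ∀ b (f : Fin m → Bool) → countF (λ i → b ∧ f i) ≡ (if b then countF f else 0)
countF-∧ true f = refl
countF-∧ {m} false f = countF-const m false

countF-+-not : (f : Fin m → Bool) → countF f + countF (not ∘ f) ≡ m
countF-+-not {zero} f = refl
countF-+-not {suc m} f with f zero
... | true = cong suc (countF-+-not (f ∘ suc))
... | false = trans (+-suc _ _) (cong suc (countF-+-not (f ∘ suc)))

countF-== : (p : Fin m) → countF (p ==_) ≡ 1
countF-== {suc m} zero = cong suc (countF-const m false)
countF-== {suc m} (suc p) = trans (countF-cong (==-injective suc-injective p)) (countF-== p)

countF-≢ : (p : Fin m) → countF (λ q → not (p == q)) ≡ m ∸ 1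
countF-≢ {m} p = begin
  countF (λ q → not (p == q))                  ≡⟨ m+n∸m≡n 1 _ ⟨
  1 + countF (λ q → not (p == q)) ∸ 1          ≡⟨ cong (λ c → c + countF (λ q → not (p == q)) ∸ 1) (countF-== p) ⟨
  countF (p ==_) + countF (λ q → not (p == q)) ∸ 1  ≡⟨ cong (_∸ 1) (countF-+-not (p ==_)) ⟩
  m ∸ 1                                        ∎
  where open ≡-Reasoning

sumF-if : (f : Fin m → Bool) (c : ℕ) → sumF (λ i → if f i then c else 0) ≡ countF f * c
sumF-if {zero} f c = refl
sumF-if {suc m} f c with f zero
... | true = cong (c +_) (sumF-if (f ∘ suc) c)
... | false = sumF-if (f ∘ suc) c

∣p∣≡countF-lookup : (p : Subset m) → ∣ p ∣ ≡ countF (Vec.lookup p)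
∣p∣≡countF-lookup Vec.[] = refl
∣p∣≡countF-lookup (true Vec.∷ p) = cong suc (∣p∣≡countF-lookup p)
∣p∣≡countF-lookup (false Vec.∷ p) = ∣p∣≡countF-lookup p

countF-disjoint-≤ : {f g h : Fin m → Bool} → (∀ i → f i ∧ g i ≡ false) → (∀ i → f i ∨ g i ≡ true → h i ≡ true) →
                    countF f + countF g ≤ countF h
countF-disjoint-≤ {f = f} {g} {h} disjoint covered = begin
  countF f + countF g              ≡⟨ cong₂ _+_ (countF≡sumF f) (countF≡sumF g) ⟩
  sumF (𝟙 ∘ f) + sumF (𝟙 ∘ g)      ≡⟨ sumF-+ (𝟙 ∘ f) (𝟙 ∘ g) ⟨
  sumF (λ i → 𝟙 (f i) + 𝟙 (g i))   ≤⟨ sumF-mono (λ i → pointwise (f i) (g i) (h i) (disjoint i) (covered i)) ⟩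
  sumF (𝟙 ∘ h)                     ≡⟨ countF≡sumF h ⟨
  countF h                         ∎
  where
  open ≤-Reasoning
  pointwise : ∀ a b c → a ∧ b ≡ false → (a ∨ b ≡ true → c ≡ true) → 𝟙 a + 𝟙 b ≤ 𝟙 c
  pointwise true true c () _
  pointwise true false c _ a∨b⇒c rewrite a∨b⇒c refl = ≤-refl
  pointwise false true c _ a∨b⇒c rewrite a∨b⇒c refl = ≤-refl
  pointwise false false c _ _ = z≤n

module _ {r : ℕ} (G : PGraph r) where

  Symmetric : Set
  Symmetric = ∀ x y → adj G x y ≡ adj G y x

  Irreflexive : Set
  Irreflexive = ∀ x → adj G x x ≡ false

  IsClique : (Fin m → Fin (n G)) → Set
  IsClique f = ∀ i j → i ≢ j → adj G (f i) (f j) ≡ true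

  degree : Fin (n G) → ℕ
  degree x = countF (adj G x)

module _ {r : ℕ} {G : PGraph r} where

  clique-injective : {f : Fin m → Fin (n G)} → Irreflexive G → IsClique G f → Injective _≡_ _≡_ f
  clique-injective {f = f} irr clique {i} {j} fi≡fj with i ≟ j
  ... | yes i≡j = i≡j
  ... | no i≢j = contradiction (trans (sym (clique i j i≢j)) (trans (cong (adj G (f i)) (sym fi≡fj)) (irr (f i)))) λ ()

  clique⇒KCopy : {f : Fin m → Fin (n G)} → Irreflexive G → IsClique G f → KCopy m G
  clique⇒KCopy {f = f} irr clique = f , clique-injective irr clique , clique

  clique-cons : Symmetric G → {f : Fin m → Fin (n G)} → IsClique G f →
                {x : Fin (n G)} → (∀ i → adj G x (f i) ≡ true) → IsClique G (x ∷ f)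
  clique-cons symmetric clique x~f zero zero 0≢0 = contradiction refl 0≢0
  clique-cons symmetric clique x~f zero (suc j) _ = x~f j
  clique-cons symmetric clique x~f (suc i) zero _ = trans (symmetric _ _) (x~f i)
  clique-cons symmetric clique x~f (suc i) (suc j) i≢j = clique i j (i≢j ∘ cong suc)

  clique-map : ∀ {r′} {G′ : PGraph r′} (e : Fin (n G) → Fin (n G′)) →
               (∀ x y → adj G x y ≡ true → adj G′ (e x) (e y) ≡ true) →
               {f : Fin m → Fin (n G)} → IsClique G f → IsClique G′ (e ∘ f)
  clique-map e hom clique i j i≢j = hom _ _ (clique i j i≢j)

  edgeless-clique-≤ : {f : Fin m → Fin (n G)} → (∀ x y → adj G x y ≡ false) → IsClique G f → m ≤ 1
  edgeless-clique-≤ {f = f} edgeless clique = injective⇒≤ {f = λ _ → zero {0}} λ {i} {j} _ → ≡-if-not-adjacent i j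
    where
    ≡-if-not-adjacent : ∀ i j → i ≡ j
    ≡-if-not-adjacent i j with i ≟ j
    ... | yes i≡j = i≡j
    ... | no i≢j = contradiction (trans (sym (clique i j i≢j)) (edgeless (f i) (f j))) λ ()

  singleton-clique : (x : Fin (n G)) → IsClique G (λ (_ : Fin 1) → x)
  singleton-clique x zero zero 0≢0 = contradiction refl 0≢0

  pComplement-symmetric : Symmetric G → Symmetric (pComplement G)
  pComplement-symmetric symmetric x y = cong₂ (λ a b → not a ∧ not b) (==-sym (cls G x) (cls G y)) (symmetric x y)

  pComplement-irreflexive : Irreflexive (pComplement G)
  pComplement-irreflexive x rewrite ==-refl (cls G x) = refl

  pComplement-separates : ∀ x y → adj (pComplement G) x y ≡ true → cls G x ≢ cls G y
  pComplement-separates x y x~y cx≡cy rewrite cx≡cy | ==-refl (cls G y) = contradiction x~y λ ()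

  pComplement-clique-cls-injective : {f : Fin m → Fin (n G)} → IsClique (pComplement G) f → Injective _≡_ _≡_ (cls G ∘ f)
  pComplement-clique-cls-injective clique {i} {j} ci≡cj with i ≟ j
  ... | yes i≡j = i≡j
  ... | no i≢j = contradiction ci≡cj (pComplement-separates _ _ (clique i j i≢j))

  module _ {u v : Fin (n G)} where

    addEdge-⊇ : ∀ {x y} → adj G x y ≡ true → adj (addEdge G u v) x y ≡ true
    addEdge-⊇ x~y rewrite x~y = refl

    addEdge-joins : adj (addEdge G u v) u v ≡ true
    addEdge-joins rewrite ==-refl u | ==-refl v = ∨-zeroʳ (adj G u v)

    addEdge-flip : ∀ x y → adj (addEdge G u v) x y ≡ adj (addEdge G v u) x y
    addEdge-flip x y = cong (adj G x y ∨_) (∨-comm (x == u ∧ y == v) (x == v ∧ y == u))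

    addEdge-symmetric : Symmetric G → Symmetric (addEdge G u v)
    addEdge-symmetric symmetric x y = cong₂ _∨_ (symmetric x y)
      (trans (∨-comm (x == u ∧ y == v) (x == v ∧ y == u)) (cong₂ _∨_ (∧-comm (x == v) (y == u)) (∧-comm (x == u) (y == v))))

    addEdge-irreflexive : u ≢ v → Irreflexive G → Irreflexive (addEdge G u v)
    addEdge-irreflexive u≢v irr x = cong₂ _∨_ (irr x) (cong₂ _∨_ not-both (trans (∧-comm (x == v) (x == u)) not-both))
      where
      not-both : (x == u ∧ x == v) ≡ false
      not-both with x == u in x≡u | x == v in x≡v
      ... | true | true = contradiction (trans (sym (==⇒≡ x≡u)) (==⇒≡ x≡v)) u≢v
      ... | true | false = refl
      ... | false | _ = refl

  addEdge-embedding : ∀ {r′} {G′ : PGraph r′} {e : Fin (n G) → Fin (n G′)} → Injective _≡_ _≡_ e →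
                      (∀ x y → adj G′ (e x) (e y) ≡ adj G x y) →
                      ∀ u v x y → adj (addEdge G′ (e u) (e v)) (e x) (e y) ≡ adj (addEdge G u v) x y
  addEdge-embedding e-inj e-adj u v x y =
    cong₂ _∨_ (e-adj x y) (cong₂ _∨_ (cong₂ _∧_ (==-inj x u) (==-inj y v)) (cong₂ _∧_ (==-inj x v) (==-inj y u)))
    where ==-inj = ==-injective e-inj

  edges-backward : Symmetric G → sumF (λ u → countF (λ v → (toℕ v <ᵇ toℕ u) ∧ adj G u v)) ≡ edges G
  edges-backward symmetric = begin
    sumF (λ u → countF (λ v → (toℕ v <ᵇ toℕ u) ∧ adj G u v))
      ≡⟨ sumF-cong (λ u → countF≡sumF (λ v → (toℕ v <ᵇ toℕ u) ∧ adj G u v)) ⟩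
    sumF (λ u → sumF (λ v → 𝟙 ((toℕ v <ᵇ toℕ u) ∧ adj G u v)))
      ≡⟨ sumF-comm (λ u v → 𝟙 ((toℕ v <ᵇ toℕ u) ∧ adj G u v)) ⟩
    sumF (λ v → sumF (λ u → 𝟙 ((toℕ v <ᵇ toℕ u) ∧ adj G u v)))
      ≡⟨ sumF-cong (λ v → sumF-cong (λ u → cong (λ b → 𝟙 ((toℕ v <ᵇ toℕ u) ∧ b)) (symmetric u v))) ⟩
    sumF (λ v → sumF (λ u → 𝟙 ((toℕ v <ᵇ toℕ u) ∧ adj G v u)))
      ≡⟨ sumF-cong (λ v → countF≡sumF (λ u → (toℕ v <ᵇ toℕ u) ∧ adj G v u)) ⟨
    edges G ∎
    where open ≡-Reasoning

  handshake-≤ : Symmetric G → 2 * edges G ≤ sumF (degree G)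
  handshake-≤ symmetric = begin
    2 * edges G                                          ≡⟨ cong (edges G +_) (+-identityʳ (edges G)) ⟩
    edges G + edges G                                    ≡⟨ cong (edges G +_) (edges-backward symmetric) ⟨
    sumF (forward) + sumF (backward)                     ≡⟨ sumF-+ forward backward ⟨
    sumF (λ u → forward u + backward u)                  ≤⟨ sumF-mono (λ u → countF-disjoint-≤ (disjoint u) (covered u)) ⟩
    sumF (degree G)                                      ∎
    where
    open ≤-Reasoning
    forward backward : Fin (n G) → ℕ
    forward u = countF (λ v → (toℕ u <ᵇ toℕ v) ∧ adj G u v)
    backward u = countF (λ v → (toℕ v <ᵇ toℕ u) ∧ adj G u v)
    disjoint : ∀ u v → ((toℕ u <ᵇ toℕ v) ∧ adj G u v) ∧ ((toℕ v <ᵇ toℕ u) ∧ adj G u v) ≡ false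
    disjoint u v with adj G u v
    ... | false = cong₂ _∧_ (∧-zeroʳ (toℕ u <ᵇ toℕ v)) refl
    ... | true = trans (cong₂ _∧_ (∧-identityʳ (toℕ u <ᵇ toℕ v)) (∧-identityʳ (toℕ v <ᵇ toℕ u))) (<ᵇ-asym (toℕ u) (toℕ v))
    covered : ∀ u v → ((toℕ u <ᵇ toℕ v) ∧ adj G u v) ∨ ((toℕ v <ᵇ toℕ u) ∧ adj G u v) ≡ true → adj G u v ≡ true
    covered u v with adj G u v
    ... | true = λ _ → refl
    ... | false = λ ff≡t → trans (sym (cong₂ _∨_ (∧-zeroʳ (toℕ u <ᵇ toℕ v)) (∧-zeroʳ (toℕ v <ᵇ toℕ u)))) ff≡t

-- Arithmetic of the vertex count

sumPow-suc : ∀ s k → s * sumPow s k + s ≡ sumPow s (suc k)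
sumPow-suc s zero = base s
  where
  base : ∀ s → s * 0 + s ≡ 0 + s * 1
  base = solve-∀
sumPow-suc s (suc k) = begin
  s * (sumPow s k + s ^ suc k) + s      ≡⟨ regroup s (sumPow s k) (s ^ suc k) ⟩
  (s * sumPow s k + s) + s ^ suc (suc k)  ≡⟨ cong (_+ s ^ suc (suc k)) (sumPow-suc s k) ⟩
  sumPow s (suc k) + s ^ suc (suc k)      ∎
  where
  open ≡-Reasoning
  regroup : ∀ s P X → s * (P + X) + s ≡ (s * P + s) + s * X
  regroup = solve-∀

Nv≡sumPow+4s^[k+1] : ∀ s k → Nv s k ≡ sumPow s k + 4 * s ^ suc k
Nv≡sumPow+4s^[k+1] s zero = base s
  where
  base : ∀ s → 2 * s + 2 * s ≡ 0 + 4 * (s * 1)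
  base = solve-∀
Nv≡sumPow+4s^[k+1] s (suc k) = begin
  s * Nv s k + s                              ≡⟨ cong (λ N → s * N + s) (Nv≡sumPow+4s^[k+1] s k) ⟩
  s * (sumPow s k + 4 * s ^ suc k) + s        ≡⟨ regroup s (sumPow s k) (s ^ suc k) ⟩
  (s * sumPow s k + s) + 4 * s ^ suc (suc k)  ≡⟨ cong (_+ 4 * s ^ suc (suc k)) (sumPow-suc s k) ⟩
  sumPow s (suc k) + 4 * s ^ suc (suc k)      ∎
  where
  open ≡-Reasoning
  regroup : ∀ s P X → s * (P + 4 * X) + s ≡ (s * P + s) + 4 * (s * X)
  regroup = solve-∀

pred*Nv+s+3s^[k+1]≡4s^[k+2] : ∀ s k → (s ∸ 1) * Nv s k + s + 3 * s ^ suc k ≡ 4 * s ^ suc (suc k)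
pred*Nv+s+3s^[k+1]≡4s^[k+2] zero k = refl
pred*Nv+s+3s^[k+1]≡4s^[k+2] (suc t) zero = base t
  where
  base : ∀ t → t * (2 * suc t + 2 * suc t) + suc t + 3 * (suc t * 1) ≡ 4 * (suc t * (suc t * 1))
  base = solve-∀
pred*Nv+s+3s^[k+1]≡4s^[k+2] s@(suc t) (suc k) = begin
  t * (s * Nv s k + s) + s + 3 * (s * s ^ suc k)  ≡⟨ regroup t (Nv s k) (s ^ suc k) ⟩
  s * (t * Nv s k + s + 3 * s ^ suc k)            ≡⟨ cong (s *_) (pred*Nv+s+3s^[k+1]≡4s^[k+2] s k) ⟩
  s * (4 * s ^ suc (suc k))                       ≡⟨ x∙yz≈y∙xz s 4 (s ^ suc (suc k)) ⟩
  4 * s ^ suc (suc (suc k))                       ∎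
  where
  open ≡-Reasoning
  regroup : ∀ t N X → t * (suc t * N + suc t) + suc t + 3 * (suc t * X) ≡ suc t * (t * N + suc t + 3 * X)
  regroup = solve-∀

pred*Nv≡s*[4s^[k+1]∸3s^k∸1] : ∀ s k → (s ∸ 1) * Nv s k ≡ s * (4 * s ^ suc k ∸ 3 * s ^ k ∸ 1)
pred*Nv≡s*[4s^[k+1]∸3s^k∸1] s k = sym (begin
  s * (4 * X ∸ 3 * Y ∸ 1)                ≡⟨ *-distribˡ-∸ s (4 * X ∸ 3 * Y) 1 ⟩
  s * (4 * X ∸ 3 * Y) ∸ s * 1            ≡⟨ cong₂ _∸_ (*-distribˡ-∸ s (4 * X) (3 * Y)) (*-identityʳ s) ⟩
  s * (4 * X) ∸ s * (3 * Y) ∸ s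
    ≡⟨ cong₂ (λ a b → a ∸ b ∸ s) (trans (x∙yz≈y∙xz s 4 X) (sym (pred*Nv+s+3s^[k+1]≡4s^[k+2] s k))) (x∙yz≈y∙xz s 3 Y) ⟩
  (s ∸ 1) * Nv s k + s + 3 * X ∸ 3 * X ∸ s  ≡⟨ cong (_∸ s) (m+n∸n≡m ((s ∸ 1) * Nv s k + s) (3 * X)) ⟩
  (s ∸ 1) * Nv s k + s ∸ s               ≡⟨ m+n∸n≡m ((s ∸ 1) * Nv s k) s ⟩
  (s ∸ 1) * Nv s k                       ∎)
  where
  open ≡-Reasoning
  X = s ^ suc k
  Y = s ^ k

pred*Nv≤4s^[k+2] : ∀ s k → (s ∸ 1) * Nv s k ≤ 4 * s ^ suc (suc k)
pred*Nv≤4s^[k+2] s k = subst ((s ∸ 1) * Nv s k ≤_) (pred*Nv+s+3s^[k+1]≡4s^[k+2] s k)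
  (≤-trans (m≤m+n ((s ∸ 1) * Nv s k) s) (m≤m+n _ (3 * s ^ suc k)))

-- The construction: copies and apices

module _ (s : ℕ) where

  copy : ∀ k → Fin s → Fin (Nv s k) → Fin (Nv s (suc k))
  copy k p a = combine p a ↑ˡ s

  apex : ∀ k → Fin s → Fin (Nv s (suc k))
  apex k x = (s * Nv s k) ↑ʳ x

  left right : Fin (2 * s) → Fin (Nv s zero)
  left i = i ↑ˡ (2 * s)
  right i = (2 * s) ↑ʳ i

  data BaseView : Fin (Nv s zero) → Set where
    on-left  : ∀ i → BaseView (left i)
    on-right : ∀ i → BaseView (right i)

  data StepView {k} : Fin (Nv s (suc k)) → Set where
    in-copy : ∀ p a → StepView (copy k p a)
    at-apex : ∀ x → StepView (apex k x)

  baseView : ∀ u → BaseView u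
  baseView u with splitAt (2 * s) u in eq
  ... | inj₁ i = subst BaseView (splitAt⁻¹-↑ˡ eq) (on-left i)
  ... | inj₂ i = subst BaseView (splitAt⁻¹-↑ʳ eq) (on-right i)

  stepView : ∀ k u → StepView {k} u
  stepView k u with splitAt (s * Nv s k) u in eq
  ... | inj₁ c = subst StepView (trans (cong (_↑ˡ s) (combine-remQuot {s} (Nv s k) c)) (splitAt⁻¹-↑ˡ eq))
                   (uncurry in-copy (remQuot {s} (Nv s k) c))
  ... | inj₂ x = subst StepView (splitAt⁻¹-↑ʳ eq) (at-apex x)

  copy-injective : ∀ {k p q} {a b : Fin (Nv s k)} → copy k p a ≡ copy k q b → p ≡ q × a ≡ b
  copy-injective {p = p} {q} {a} {b} eq = combine-injective p a q b (↑ˡ-injective s _ _ eq)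

  private
    quotRem-combine : ∀ {k} p a → quotRem {s} (Nv s k) (combine p a) ≡ (a , p)
    quotRem-combine {k} p a = cong swap (remQuot-combine {s} {Nv s k} p a)

  module _ {k : ℕ} where

    adjG-copy-copy : ∀ p a q b → adjG s (suc k) (copy k p a) (copy k q b) ≡ (p == q) ∧ adjG s k a b
    adjG-copy-copy p a q b rewrite splitAt-↑ˡ (s * Nv s k) (combine p a) s | splitAt-↑ˡ (s * Nv s k) (combine q b) s
      | quotRem-combine {k} p a | quotRem-combine {k} q b = refl

    adjG-copy-apex : ∀ p a x → adjG s (suc k) (copy k p a) (apex k x) ≡ not (p == x)
    adjG-copy-apex p a x rewrite splitAt-↑ˡ (s * Nv s k) (combine p a) s | splitAt-↑ʳ (s * Nv s k) s x
      | quotRem-combine {k} p a = refl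

    adjG-apex-copy : ∀ x q b → adjG s (suc k) (apex k x) (copy k q b) ≡ not (x == q)
    adjG-apex-copy x q b rewrite splitAt-↑ˡ (s * Nv s k) (combine q b) s | splitAt-↑ʳ (s * Nv s k) s x
      | quotRem-combine {k} q b = refl

    adjG-apex-apex : ∀ x y → adjG s (suc k) (apex k x) (apex k y) ≡ false
    adjG-apex-apex x y rewrite splitAt-↑ʳ (s * Nv s k) s x | splitAt-↑ʳ (s * Nv s k) s y = refl

    clsG-copy : ∀ p a → clsG s (suc k) (copy k p a) ≡ inject₁ (clsG s k a)
    clsG-copy p a rewrite splitAt-↑ˡ (s * Nv s k) (combine p a) s | quotRem-combine {k} p a = refl

    clsG-apex : ∀ x → clsG s (suc k) (apex k x) ≡ fromℕ (suc (suc k))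
    clsG-apex x rewrite splitAt-↑ʳ (s * Nv s k) s x = refl

  adjG-left-left : ∀ i j → adjG s zero (left i) (left j) ≡ false
  adjG-left-left i j rewrite splitAt-↑ˡ (2 * s) i (2 * s) | splitAt-↑ˡ (2 * s) j (2 * s) = refl

  adjG-left-right : ∀ i j → adjG s zero (left i) (right j) ≡ true
  adjG-left-right i j rewrite splitAt-↑ˡ (2 * s) i (2 * s) | splitAt-↑ʳ (2 * s) (2 * s) j = refl

  adjG-right-left : ∀ i j → adjG s zero (right i) (left j) ≡ true
  adjG-right-left i j rewrite splitAt-↑ʳ (2 * s) (2 * s) i | splitAt-↑ˡ (2 * s) j (2 * s) = refl

  adjG-right-right : ∀ i j → adjG s zero (right i) (right j) ≡ false
  adjG-right-right i j rewrite splitAt-↑ʳ (2 * s) (2 * s) i | splitAt-↑ʳ (2 * s) (2 * s) j = refl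

  clsG-left : ∀ i → clsG s zero (left i) ≡ zero
  clsG-left i rewrite splitAt-↑ˡ (2 * s) i (2 * s) = refl

  clsG-right : ∀ i → clsG s zero (right i) ≡ suc zero
  clsG-right i rewrite splitAt-↑ʳ (2 * s) (2 * s) i = refl

  adjG-symmetric : ∀ k → Symmetric (Grs k s)
  adjG-symmetric zero u v with baseView u | baseView v
  ... | on-left i  | on-left j  = trans (adjG-left-left i j) (sym (adjG-left-left j i))
  ... | on-left i  | on-right j = trans (adjG-left-right i j) (sym (adjG-right-left j i))
  ... | on-right i | on-left j  = trans (adjG-right-left i j) (sym (adjG-left-right j i))
  ... | on-right i | on-right j = trans (adjG-right-right i j) (sym (adjG-right-right j i))
  adjG-symmetric (suc k) u v with stepView k u | stepView k v
  ... | in-copy p a | in-copy q b = begin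
    adjG s (suc k) (copy k p a) (copy k q b)  ≡⟨ adjG-copy-copy p a q b ⟩
    (p == q) ∧ adjG s k a b                   ≡⟨ cong₂ _∧_ (==-sym p q) (adjG-symmetric k a b) ⟩
    (q == p) ∧ adjG s k b a                   ≡⟨ adjG-copy-copy q b p a ⟨
    adjG s (suc k) (copy k q b) (copy k p a)  ∎
    where open ≡-Reasoning
  ... | in-copy p a | at-apex x = trans (adjG-copy-apex p a x) (trans (cong not (==-sym p x)) (sym (adjG-apex-copy x p a)))
  ... | at-apex x | in-copy q b = trans (adjG-apex-copy x q b) (trans (cong not (==-sym x q)) (sym (adjG-copy-apex q b x)))
  ... | at-apex x | at-apex y = trans (adjG-apex-apex x y) (sym (adjG-apex-apex y x))

  adjG-partite : ∀ k u v → adjG s k u v ≡ true → clsG s k u ≢ clsG s k v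
  adjG-partite zero u v u~v with baseView u | baseView v
  ... | on-left i  | on-left j  = contradiction (trans (sym u~v) (adjG-left-left i j)) λ ()
  ... | on-left i  | on-right j = λ eq → contradiction (trans (sym (clsG-left i)) (trans eq (clsG-right j))) λ ()
  ... | on-right i | on-left j  = λ eq → contradiction (trans (sym (clsG-right i)) (trans eq (clsG-left j))) λ ()
  ... | on-right i | on-right j = contradiction (trans (sym u~v) (adjG-right-right i j)) λ ()
  adjG-partite (suc k) u v u~v with stepView k u | stepView k v
  ... | in-copy p a | in-copy q b = λ eq →
    adjG-partite k a b (proj₂ (∧-true (trans (sym (adjG-copy-copy p a q b)) u~v)))
      (inject₁-injective (trans (sym (clsG-copy p a)) (trans eq (clsG-copy q b))))
  ... | in-copy p a | at-apex x = λ eq → fromℕ≢inject₁ (trans (sym (clsG-apex x)) (trans (sym eq) (clsG-copy p a)))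
  ... | at-apex x | in-copy q b = λ eq → fromℕ≢inject₁ (trans (sym (clsG-apex x)) (trans eq (clsG-copy q b)))
  ... | at-apex x | at-apex y = contradiction (trans (sym u~v) (adjG-apex-apex x y)) λ ()

  -- Cliques in the r-partite complement

  Gᶜ : ∀ k → PGraph (suc (suc k))
  Gᶜ k = pComplement (Grs k s)

  Gᶜ-symmetric : ∀ k → Symmetric (Gᶜ k)
  Gᶜ-symmetric k = pComplement-symmetric (adjG-symmetric k)

  Gᶜ-base : ∀ x y → adj (Gᶜ zero) x y ≡ false
  Gᶜ-base x y with baseView x | baseView y
  ... | on-left i  | on-left j  rewrite clsG-left i | clsG-left j = refl
  ... | on-left i  | on-right j rewrite clsG-left i | clsG-right j | adjG-left-right i j = refl
  ... | on-right i | on-left j  rewrite clsG-right i | clsG-left j | adjG-right-left i j = refl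
  ... | on-right i | on-right j rewrite clsG-right i | clsG-right j = refl

  module _ {k : ℕ} where

    Gᶜ-copy : ∀ p a b → adj (Gᶜ (suc k)) (copy k p a) (copy k p b) ≡ adj (Gᶜ k) a b
    Gᶜ-copy p a b rewrite clsG-copy {k} p a | clsG-copy {k} p b | ==-injective inject₁-injective (clsG s k a) (clsG s k b)
      | adjG-copy-copy {k} p a p b | ==-refl p = refl

    Gᶜ-copy-copy-≢ : ∀ {p q} a b → p ≢ q → adj (Gᶜ (suc k)) (copy k p a) (copy k q b) ≡ not (clsG s k a == clsG s k b)
    Gᶜ-copy-copy-≢ {p} {q} a b p≢q rewrite clsG-copy {k} p a | clsG-copy {k} q b | ==-injective inject₁-injective (clsG s k a) (clsG s k b)
      | adjG-copy-copy {k} p a q b | ≢⇒== p≢q = ∧-identityʳ _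

    Gᶜ-apex-copy : ∀ x a → adj (Gᶜ (suc k)) (apex k x) (copy k x a) ≡ true
    Gᶜ-apex-copy x a rewrite clsG-apex {k} x | clsG-copy {k} x a | ≢⇒== (fromℕ≢inject₁ {i = clsG s k a})
      | adjG-apex-copy {k} x x a | ==-refl x = refl

    Gᶜ-apex-copy-≢ : ∀ {x q} a → x ≢ q → adj (Gᶜ (suc k)) (apex k x) (copy k q a) ≡ false
    Gᶜ-apex-copy-≢ {x} {q} a x≢q rewrite clsG-apex {k} x | clsG-copy {k} q a | ≢⇒== (fromℕ≢inject₁ {i = clsG s k a})
      | adjG-apex-copy {k} x q a | ≢⇒== x≢q = refl

    Gᶜ-apex-apex : ∀ x y → adj (Gᶜ (suc k)) (apex k x) (apex k y) ≡ false
    Gᶜ-apex-apex x y rewrite clsG-apex {k} x | clsG-apex {k} y | ==-refl (fromℕ (suc (suc k))) = refl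

  apex-of-top-class : ∀ k u → clsG s (suc k) u ≡ fromℕ (suc (suc k)) → Σ (Fin s) λ x → u ≡ apex k x
  apex-of-top-class k u top with stepView k u
  ... | in-copy p a = contradiction (trans (sym top) (clsG-copy p a)) fromℕ≢inject₁
  ... | at-apex x = x , refl

  Gᶜ-apex-neighbour : ∀ k x v → adj (Gᶜ (suc k)) (apex k x) v ≡ true → Σ (Fin (Nv s k)) λ b → v ≡ copy k x b
  Gᶜ-apex-neighbour k x v x~v with stepView k v
  ... | at-apex y = contradiction (trans (sym x~v) (Gᶜ-apex-apex x y)) λ ()
  ... | in-copy q b with x ≟ q
  ...   | yes refl = b , refl
  ...   | no x≢q = contradiction (trans (sym x~v) (Gᶜ-apex-copy-≢ b x≢q)) λ ()

  Gᶜ-clique-≤ : ∀ k {m} {f : Fin m → Fin (Nv s k)} → IsClique (Gᶜ k) f → m ≤ suc k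
  Gᶜ-clique-≤ zero clique = edgeless-clique-≤ {G = Gᶜ zero} Gᶜ-base clique
  Gᶜ-clique-≤ (suc k) {zero} clique = z≤n
  -- A clique meeting the top class contains an apex x and lies otherwise in copy x;
  -- a clique missing it has at most one vertex in each of the remaining classes.
  Gᶜ-clique-≤ (suc k) {suc m} {f} clique with any? (λ i → clsG s (suc k) (f i) ≟ fromℕ (suc (suc k)))
  ... | no no-top = injective-missing⇒≤ (fromℕ (suc (suc k)))
                      (pComplement-clique-cls-injective {G = Grs (suc k) s} clique) (λ i top → no-top (i , top))
  ... | yes (i , top) with apex-of-top-class k (f i) top
  ...   | x , fi≡apex = s≤s (Gᶜ-clique-≤ k inner-clique)
    where
    other : Fin m → Fin (Nv s (suc k))
    other j = f (punchIn i j)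
    in-copy-x : ∀ j → Σ (Fin (Nv s k)) λ b → other j ≡ copy k x b
    in-copy-x j = Gᶜ-apex-neighbour k x (other j)
      (subst (λ w → adj (Gᶜ (suc k)) w (other j) ≡ true) fi≡apex (clique i (punchIn i j) (punchInᵢ≢i i j ∘ sym)))
    inner : Fin m → Fin (Nv s k)
    inner j = proj₁ (in-copy-x j)
    inner-clique : IsClique (Gᶜ k) inner
    inner-clique j j′ j≢j′ = trans (sym (Gᶜ-copy x (inner j) (inner j′)))
      (subst₂ (λ a b → adj (Gᶜ (suc k)) a b ≡ true) (proj₂ (in-copy-x j)) (proj₂ (in-copy-x j′))
        (clique (punchIn i j) (punchIn i j′) (j≢j′ ∘ punchIn-injective i j j′)))

  Gᶜ-Kᵣ-free : ∀ k → ¬ KCopy (suc (suc k)) (Gᶜ k)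
  Gᶜ-Kᵣ-free k (_ , _ , clique) = 1+n≰n (Gᶜ-clique-≤ k clique)

  Gᶜ-copy-clique : ∀ {k m} (p : Fin s) {f : Fin m → Fin (Nv s k)} → IsClique (Gᶜ k) f → IsClique (Gᶜ (suc k)) (copy k p ∘ f)
  Gᶜ-copy-clique {k} p = clique-map {G = Gᶜ k} {G′ = Gᶜ (suc k)} (copy k p) (λ x y → trans (Gᶜ-copy {k} p x y))

  -- p only witnesses that s > 0.
  class-zero-vertex : Fin s → ∀ k → Σ (Fin (Nv s k)) λ v → clsG s k v ≡ zero
  class-zero-vertex p zero = left (p ↑ˡ _) , clsG-left (p ↑ˡ _)
  class-zero-vertex p (suc k) with class-zero-vertex p k
  ... | v , v∈A₁ = copy k p v , trans (clsG-copy p v) (cong inject₁ v∈A₁)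

  Gᶜ-avoiding-clique : ∀ {p q : Fin s} → p ≢ q → ∀ k (c : Fin (suc (suc k))) →
                       Σ (Fin (suc k) → Fin (Nv s k)) λ f → IsClique (Gᶜ k) f × (∀ i → clsG s k (f i) ≢ c)
  Gᶜ-avoiding-clique {p} p≢q zero zero =
    (λ _ → right (p ↑ˡ _)) , singleton-clique {G = Gᶜ zero} _ , λ _ eq → contradiction (trans (sym (clsG-right _)) eq) λ ()
  Gᶜ-avoiding-clique {p} p≢q zero (suc zero) =
    (λ _ → left (p ↑ˡ _)) , singleton-clique {G = Gᶜ zero} _ , λ _ eq → contradiction (trans (sym (clsG-left _)) eq) λ ()
  -- Avoiding the top class: a vertex of A₁ in copy q and a clique of copy p avoiding A₁.
  -- Avoiding an old class: the apex of p and a clique of copy p avoiding that class.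
  Gᶜ-avoiding-clique {p} {q} p≢q (suc k) c with topView c
  ... | ‵fromℕ with Gᶜ-avoiding-clique p≢q k zero | class-zero-vertex p k
  ...   | g , g-clique , g∉A₁ | w , w∈A₁ =
    copy k q w ∷ (copy k p ∘ g) , clique-cons {G = Gᶜ (suc k)} (Gᶜ-symmetric (suc k)) (Gᶜ-copy-clique p g-clique) w~g , avoids
    where
    w~g : ∀ t → adj (Gᶜ (suc k)) (copy k q w) (copy k p (g t)) ≡ true
    w~g t = trans (Gᶜ-copy-copy-≢ w (g t) (p≢q ∘ sym)) (cong not (≢⇒== λ eq → g∉A₁ t (trans (sym eq) w∈A₁)))
    avoids : ∀ i → clsG s (suc k) ((copy k q w ∷ (copy k p ∘ g)) i) ≢ fromℕ (suc (suc k))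
    avoids zero eq = fromℕ≢inject₁ (trans (sym eq) (clsG-copy q w))
    avoids (suc t) eq = fromℕ≢inject₁ (trans (sym eq) (clsG-copy p (g t)))
  Gᶜ-avoiding-clique {p} {q} p≢q (suc k) c | ‵inject₁ j with Gᶜ-avoiding-clique p≢q k j
  ...   | g , g-clique , g∉Aⱼ =
    apex k p ∷ (copy k p ∘ g) , clique-cons {G = Gᶜ (suc k)} (Gᶜ-symmetric (suc k)) (Gᶜ-copy-clique p g-clique) (λ t → Gᶜ-apex-copy p (g t)) , avoids
    where
    avoids : ∀ i → clsG s (suc k) ((apex k p ∷ (copy k p ∘ g)) i) ≢ inject₁ j
    avoids zero eq = fromℕ≢inject₁ (trans (sym (clsG-apex p)) eq)
    avoids (suc t) eq = g∉Aⱼ t (inject₁-injective (trans (sym (clsG-copy p (g t))) eq))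

  Gᶜ-Kᵣ₋₁-avoiding : ∀ {p q : Fin s} → p ≢ q → ∀ k c → KCopyAvoiding (suc k) (Gᶜ k) c
  Gᶜ-Kᵣ₋₁-avoiding p≢q k c with Gᶜ-avoiding-clique p≢q k c
  ... | f , clique , avoids = f , clique-injective {G = Gᶜ k} (pComplement-irreflexive {G = Grs k s}) clique , clique , avoids

  Saturating : ∀ k → Fin (Nv s k) → Fin (Nv s k) → Set
  Saturating k u v = Σ (Fin (suc (suc k)) → Fin (Nv s k)) (IsClique (addEdge (Gᶜ k) u v))

  private
    Gᶜ⁺-symmetric : ∀ k {u v} → Symmetric (addEdge (Gᶜ k) u v)
    Gᶜ⁺-symmetric k = addEdge-symmetric {G = Gᶜ k} (Gᶜ-symmetric k)

  saturating-flip : ∀ k {u v} → Saturating k u v → Saturating k v u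
  saturating-flip k {u} {v} (f , clique) =
    f , clique-map {G = addEdge (Gᶜ k) u v} {G′ = addEdge (Gᶜ k) v u} (λ x → x) (λ x y → trans (sym (addEdge-flip {G = Gᶜ k} x y))) clique

  saturating-copy-apex : ∀ k {p x} a → p ≢ x → Saturating (suc k) (copy k p a) (apex k x)
  saturating-copy-apex k {p} {x} a p≢x with Gᶜ-avoiding-clique p≢x k (clsG s k a)
  ... | g , g-clique , g∉Aₐ =
    apex k x ∷ (copy k p a ∷ (copy k x ∘ g)) ,
    clique-cons {G = G⁺} (Gᶜ⁺-symmetric (suc k)) (clique-cons {G = G⁺} (Gᶜ⁺-symmetric (suc k)) g-clique⁺ a~g) x~rest
    where
    G⁺ : PGraph (suc (suc (suc k)))
    G⁺ = addEdge (Gᶜ (suc k)) (copy k p a) (apex k x)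
    g-clique⁺ : IsClique G⁺ (copy k x ∘ g)
    g-clique⁺ = clique-map {G = Gᶜ (suc k)} {G′ = G⁺} (λ y → y) (λ _ _ → addEdge-⊇ {G = Gᶜ (suc k)}) (Gᶜ-copy-clique x g-clique)
    a~g : ∀ t → adj G⁺ (copy k p a) (copy k x (g t)) ≡ true
    a~g t = addEdge-⊇ {G = Gᶜ (suc k)} (trans (Gᶜ-copy-copy-≢ a (g t) p≢x) (cong not (≢⇒== λ eq → g∉Aₐ t (sym eq))))
    x~rest : ∀ i → adj G⁺ (apex k x) ((copy k p a ∷ (copy k x ∘ g)) i) ≡ true
    x~rest zero = trans (Gᶜ⁺-symmetric (suc k) (apex k x) (copy k p a)) (addEdge-joins {G = Gᶜ (suc k)})
    x~rest (suc t) = addEdge-⊇ {G = Gᶜ (suc k)} (Gᶜ-apex-copy x (g t))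

  saturating-copy-copy : ∀ k p {a b} → Saturating k a b → Saturating (suc k) (copy k p a) (copy k p b)
  saturating-copy-copy k p {a} {b} (g , g-clique) =
    apex k p ∷ (copy k p ∘ g) ,
    clique-cons {G = G⁺} (Gᶜ⁺-symmetric (suc k)) (clique-map {G = addEdge (Gᶜ k) a b} {G′ = G⁺} (copy k p) copy-hom g-clique)
      (λ t → addEdge-⊇ {G = Gᶜ (suc k)} (Gᶜ-apex-copy p (g t)))
    where
    G⁺ : PGraph (suc (suc (suc k)))
    G⁺ = addEdge (Gᶜ (suc k)) (copy k p a) (copy k p b)
    copy-hom : ∀ x y → adj (addEdge (Gᶜ k) a b) x y ≡ true → adj G⁺ (copy k p x) (copy k p y) ≡ true
    copy-hom x y = trans (addEdge-embedding {G = Gᶜ k} {G′ = Gᶜ (suc k)} (proj₂ ∘ copy-injective {k}) (Gᶜ-copy p) a b x y)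

  Gᶜ-saturated : ∀ k u v → adjG s k u v ≡ true → Saturating k u v
  Gᶜ-saturated zero u v u~v =
    u ∷ (v ∷ []) , clique-cons {G = G⁺} (Gᶜ⁺-symmetric zero) (clique-cons {G = G⁺} (Gᶜ⁺-symmetric zero) (λ ()) λ ())
                     λ { zero → addEdge-joins {G = Gᶜ zero} ; (suc ()) }
    where
    G⁺ : PGraph 2
    G⁺ = addEdge (Gᶜ zero) u v
  Gᶜ-saturated (suc k) u v u~v with stepView k u | stepView k v
  ... | in-copy p a | in-copy q b with ∧-true (trans (sym (adjG-copy-copy p a q b)) u~v)
  ...   | p==q , a~b with ==⇒≡ {i = p} {q} p==q
  ...     | refl = saturating-copy-copy k p (Gᶜ-saturated k a b a~b)
  Gᶜ-saturated (suc k) u v u~v | in-copy p a | at-apex x =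
    saturating-copy-apex k a λ { refl → contradiction (trans (sym u~v) (trans (adjG-copy-apex p a p) (cong not (==-refl p)))) λ () }
  Gᶜ-saturated (suc k) u v u~v | at-apex x | in-copy q b =
    saturating-flip (suc k) (saturating-copy-apex k b λ { refl → contradiction (trans (sym u~v) (trans (adjG-apex-copy q q b) (cong not (==-refl q)))) λ () })
  Gᶜ-saturated (suc k) u v u~v | at-apex x | at-apex y = contradiction (trans (sym u~v) (adjG-apex-apex x y)) λ ()

  Gᶜ-saturating : ∀ k u v → adjG s k u v ≡ true → clsG s k u ≢ clsG s k v → KCopy (suc (suc k)) (addEdge (Gᶜ k) u v)
  Gᶜ-saturating k u v u~v separated =
    clique⇒KCopy {G = addEdge (Gᶜ k) u v}
      (addEdge-irreflexive {G = Gᶜ k} (separated ∘ cong (clsG s k)) (pComplement-irreflexive {G = Grs k s}))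
      (proj₂ (Gᶜ-saturated k u v u~v))

  -- Counting vertices, classes, degrees and edges

  sumF-step : ∀ k (f : Fin (Nv s (suc k)) → ℕ) → sumF f ≡ sumF (λ p → sumF (f ∘ copy k p)) + sumF (f ∘ apex k)
  sumF-step k f = trans (sumF-↑ (s * Nv s k) f) (cong (_+ sumF (f ∘ apex k)) (sumF-combine s (Nv s k) (f ∘ (_↑ˡ s))))

  countF-step : ∀ k (f : Fin (Nv s (suc k)) → Bool) → countF f ≡ sumF (λ p → countF (f ∘ copy k p)) + countF (f ∘ apex k)
  countF-step k f = begin
    countF f                                                       ≡⟨ countF≡sumF f ⟩
    sumF (𝟙 ∘ f)                                                   ≡⟨ sumF-step k (𝟙 ∘ f) ⟩
    sumF (λ p → sumF (𝟙 ∘ f ∘ copy k p)) + sumF (𝟙 ∘ f ∘ apex k)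
      ≡⟨ cong₂ _+_ (sumF-cong λ p → countF≡sumF (f ∘ copy k p)) (countF≡sumF (f ∘ apex k)) ⟨
    sumF (λ p → countF (f ∘ copy k p)) + countF (f ∘ apex k)       ∎
    where open ≡-Reasoning

  countF-base : (f : Fin (Nv s zero) → Bool) → countF f ≡ countF (f ∘ left) + countF (f ∘ right)
  countF-base f =
    trans (countF≡sumF f) (trans (sumF-↑ (2 * s) (𝟙 ∘ f)) (sym (cong₂ _+_ (countF≡sumF (f ∘ left)) (countF≡sumF (f ∘ right)))))

  classSize-base : ∀ i → classSize (Grs zero s) i ≡ 2 * s
  classSize-base i = begin
    classSize (Grs zero s) i                                         ≡⟨ countF-base (λ v → clsG s zero v == i) ⟩
    countF (λ j → clsG s zero (left j) == i) + countF (λ j → clsG s zero (right j) == i)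
      ≡⟨ cong₂ _+_ (countF-cong {2 * s} λ j → cong (_== i) (clsG-left j)) (countF-cong {2 * s} λ j → cong (_== i) (clsG-right j)) ⟩
    countF {2 * s} (λ _ → zero == i) + countF {2 * s} (λ _ → suc zero == i)
      ≡⟨ cong₂ _+_ (countF-const (2 * s) (zero == i)) (countF-const (2 * s) (suc zero == i)) ⟩
    (if zero == i then 2 * s else 0) + (if suc zero == i then 2 * s else 0)  ≡⟨ one-side i ⟩
    2 * s                                                            ∎
    where
    open ≡-Reasoning
    one-side : ∀ i → (if zero == i then 2 * s else 0) + (if suc zero == i then 2 * s else 0) ≡ 2 * s
    one-side zero = +-identityʳ (2 * s)
    one-side (suc zero) = refl

  classSize-copy : ∀ k j → classSize (Grs (suc k) s) (inject₁ j) ≡ s * classSize (Grs k s) j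
  classSize-copy k j = begin
    classSize (Grs (suc k) s) (inject₁ j)
      ≡⟨ countF-step k (λ v → clsG s (suc k) v == inject₁ j) ⟩
    sumF {s} (λ p → countF (λ a → clsG s (suc k) (copy k p a) == inject₁ j)) + countF (λ x → clsG s (suc k) (apex k x) == inject₁ j)
      ≡⟨ cong₂ _+_ (sumF-cong {s} λ p → countF-cong λ a → trans (cong (_== inject₁ j) (clsG-copy p a)) (==-injective inject₁-injective _ j))
                   (countF-cong λ x → trans (cong (_== inject₁ j) (clsG-apex x)) (≢⇒== fromℕ≢inject₁)) ⟩
    sumF {s} (λ _ → classSize (Grs k s) j) + countF (λ (_ : Fin s) → false)
      ≡⟨ cong₂ _+_ (sumF-const s _) (countF-const s false) ⟩
    s * classSize (Grs k s) j + 0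
      ≡⟨ +-identityʳ _ ⟩
    s * classSize (Grs k s) j ∎
    where open ≡-Reasoning

  classSize-apex : ∀ k → classSize (Grs (suc k) s) (fromℕ (suc (suc k))) ≡ s
  classSize-apex k = begin
    classSize (Grs (suc k) s) top
      ≡⟨ countF-step k (λ v → clsG s (suc k) v == top) ⟩
    sumF {s} (λ p → countF (λ a → clsG s (suc k) (copy k p a) == top)) + countF (λ x → clsG s (suc k) (apex k x) == top)
      ≡⟨ cong₂ _+_ (sumF-cong {s} λ p → countF-cong λ a → trans (cong (_== top) (clsG-copy p a)) (≢⇒== (fromℕ≢inject₁ ∘ sym)))
                   (countF-cong λ x → trans (cong (_== top) (clsG-apex x)) (==-refl top)) ⟩
    sumF (λ (_ : Fin s) → countF (λ (_ : Fin (Nv s k)) → false)) + countF (λ (_ : Fin s) → true)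
      ≡⟨ cong₂ _+_ (trans (sumF-cong {s} λ _ → countF-const (Nv s k) false) (trans (sumF-const s 0) (*-zeroʳ s))) (countF-const s true) ⟩
    s ∎
    where
    open ≡-Reasoning
    top = fromℕ (suc (suc k))

  classSize-A₁A₂ : ∀ k (i : Fin 2) → classSize (Grs k s) (i ↑ˡ k) ≡ 2 * s ^ suc k
  classSize-A₁A₂ zero zero = trans (classSize-base zero) (cong (2 *_) (sym (*-identityʳ s)))
  classSize-A₁A₂ zero (suc zero) = trans (classSize-base (suc zero)) (cong (2 *_) (sym (*-identityʳ s)))
  classSize-A₁A₂ (suc k) i = begin
    classSize (Grs (suc k) s) (i ↑ˡ suc k)     ≡⟨ cong (classSize (Grs (suc k) s)) (↑ˡ-suc i) ⟩
    classSize (Grs (suc k) s) (inject₁ (i ↑ˡ k)) ≡⟨ classSize-copy k (i ↑ˡ k) ⟩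
    s * classSize (Grs k s) (i ↑ˡ k)             ≡⟨ cong (s *_) (classSize-A₁A₂ k i) ⟩
    s * (2 * s ^ suc k)                               ≡⟨ x∙yz≈y∙xz s 2 (s ^ suc k) ⟩
    2 * s ^ suc (suc k)                               ∎
    where
    open ≡-Reasoning
    ↑ˡ-suc : (i : Fin 2) → i ↑ˡ suc k ≡ inject₁ (i ↑ˡ k)
    ↑ˡ-suc zero = refl
    ↑ˡ-suc (suc zero) = refl

  classSize-others : ∀ k (i : Fin (suc (suc k))) → 2 ≤ toℕ i → classSize (Grs k s) i ≤ s ^ k
  classSize-others zero (suc zero) (s≤s ())
  classSize-others (suc k) i 2≤i with topView i
  ... | ‵fromℕ = subst (_≤ s * s ^ k) (sym (classSize-apex k)) (m≤m^[1+n] s k)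
  ... | ‵inject₁ j = subst (_≤ s * s ^ k) (sym (classSize-copy k j))
                       (*-monoʳ-≤ s (classSize-others k j (subst (2 ≤_) (toℕ-inject₁ j) 2≤i)))

  degree-base : ∀ u → degree (Grs zero s) u ≡ 2 * s
  degree-base u with baseView u
  ... | on-left i = begin
    degree (Grs zero s) (left i)
      ≡⟨ countF-base (adjG s zero (left i)) ⟩
    countF (adjG s zero (left i) ∘ left) + countF (adjG s zero (left i) ∘ right)
      ≡⟨ cong₂ _+_ (trans (countF-cong (adjG-left-left i)) (countF-const (2 * s) false))
                   (trans (countF-cong (adjG-left-right i)) (countF-const (2 * s) true)) ⟩
    2 * s ∎
    where open ≡-Reasoning
  ... | on-right i = begin
    degree (Grs zero s) (right i)
      ≡⟨ countF-base (adjG s zero (right i)) ⟩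
    countF (adjG s zero (right i) ∘ left) + countF (adjG s zero (right i) ∘ right)
      ≡⟨ cong₂ _+_ (trans (countF-cong (adjG-right-left i)) (countF-const (2 * s) true))
                   (trans (countF-cong (adjG-right-right i)) (countF-const (2 * s) false)) ⟩
    2 * s + 0
      ≡⟨ +-identityʳ (2 * s) ⟩
    2 * s ∎
    where open ≡-Reasoning

  degree-copy : ∀ k p a → degree (Grs (suc k) s) (copy k p a) ≡ degree (Grs k s) a + (s ∸ 1)
  degree-copy k p a = begin
    degree (Grs (suc k) s) (copy k p a)
      ≡⟨ countF-step k (adjG s (suc k) (copy k p a)) ⟩
    sumF {s} (λ q → countF (λ b → adjG s (suc k) (copy k p a) (copy k q b))) + countF (λ x → adjG s (suc k) (copy k p a) (apex k x))
      ≡⟨ cong₂ _+_ (sumF-cong {s} λ q → trans (countF-cong (adjG-copy-copy {k} p a q)) (countF-∧ (p == q) (adjG s k a)))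
                   (countF-cong (adjG-copy-apex {k} p a)) ⟩
    sumF {s} (λ q → if p == q then degree (Grs k s) a else 0) + countF (λ x → not (p == x))
      ≡⟨ cong₂ _+_ (sumF-if (p ==_) (degree (Grs k s) a)) (countF-≢ p) ⟩
    countF (p ==_) * degree (Grs k s) a + (s ∸ 1)
      ≡⟨ cong (λ c → c * degree (Grs k s) a + (s ∸ 1)) (countF-== p) ⟩
    1 * degree (Grs k s) a + (s ∸ 1)
      ≡⟨ cong (_+ (s ∸ 1)) (*-identityˡ (degree (Grs k s) a)) ⟩
    degree (Grs k s) a + (s ∸ 1) ∎
    where open ≡-Reasoning

  degree-apex : ∀ k x → degree (Grs (suc k) s) (apex k x) ≡ (s ∸ 1) * Nv s k
  degree-apex k x = begin
    degree (Grs (suc k) s) (apex k x)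
      ≡⟨ countF-step k (adjG s (suc k) (apex k x)) ⟩
    sumF {s} (λ q → countF (λ b → adjG s (suc k) (apex k x) (copy k q b))) + countF (λ y → adjG s (suc k) (apex k x) (apex k y))
      ≡⟨ cong₂ _+_ (sumF-cong {s} λ q → trans (countF-cong (adjG-apex-copy {k} x q)) (countF-const (Nv s k) (not (x == q))))
                   (trans (countF-cong (adjG-apex-apex {k} x)) (countF-const s false)) ⟩
    sumF {s} (λ q → if not (x == q) then Nv s k else 0) + 0
      ≡⟨ +-identityʳ _ ⟩
    sumF {s} (λ q → if not (x == q) then Nv s k else 0)
      ≡⟨ sumF-if (λ q → not (x == q)) (Nv s k) ⟩
    countF (λ q → not (x == q)) * Nv s k
      ≡⟨ cong (_* Nv s k) (countF-≢ x) ⟩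
    (s ∸ 1) * Nv s k ∎
    where open ≡-Reasoning

  degreeSum : ℕ → ℕ
  degreeSum k = sumF (degree (Grs k s))

  degreeSum-suc : ∀ k → degreeSum (suc k) ≡ s * (degreeSum k + Nv s k * (s ∸ 1)) + s * ((s ∸ 1) * Nv s k)
  degreeSum-suc k = trans (sumF-step k (degree (Grs (suc k) s))) (cong₂ _+_ copies apices)
    where
    copies : sumF {s} (λ p → sumF (degree (Grs (suc k) s) ∘ copy k p)) ≡ s * (degreeSum k + Nv s k * (s ∸ 1))
    copies = trans (sumF-cong {s} λ p → trans (sumF-cong (degree-copy k p))
                                          (trans (sumF-+ (degree (Grs k s)) (λ _ → s ∸ 1)) (cong (degreeSum k +_) (sumF-const (Nv s k) (s ∸ 1)))))
                   (sumF-const s _)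
    apices : sumF (degree (Grs (suc k) s) ∘ apex k) ≡ s * ((s ∸ 1) * Nv s k)
    apices = trans (sumF-cong (degree-apex k)) (sumF-const s _)

  degreeSum-≤ : ∀ k → degreeSum k ≤ 8 * suc k * s ^ suc (suc k)
  degreeSum-≤ zero = ≤-reflexive (trans (sumF-cong degree-base) (trans (sumF-const (Nv s zero) (2 * s)) (base s)))
    where
    base : ∀ s → (2 * s + 2 * s) * (2 * s) ≡ 8 * 1 * (s * (s * 1))
    base = solve-∀
  degreeSum-≤ (suc k) = begin
    degreeSum (suc k)                                       ≡⟨ degreeSum-suc k ⟩
    s * (degreeSum k + Nv s k * (s ∸ 1)) + s * ((s ∸ 1) * Nv s k)
      ≤⟨ +-mono-≤ (*-monoʳ-≤ s (+-mono-≤ (degreeSum-≤ k) (subst (_≤ 4 * X) (*-comm (s ∸ 1) (Nv s k)) (pred*Nv≤4s^[k+2] s k))))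
                  (*-monoʳ-≤ s (pred*Nv≤4s^[k+2] s k)) ⟩
    s * (8 * suc k * X + 4 * X) + s * (4 * X)               ≡⟨ regroup s k X ⟩
    8 * suc (suc k) * s ^ suc (suc (suc k))                 ∎
    where
    open ≤-Reasoning
    X = s ^ suc (suc k)
    regroup : ∀ s k X → s * (8 * suc k * X + 4 * X) + s * (4 * X) ≡ 8 * suc (suc k) * (s * X)
    regroup = solve-∀

  edges-≤ : ∀ k → edges (Grs k s) ≤ 4 * suc k * s ^ suc (suc k)
  edges-≤ k = *-cancelˡ-≤ 2 (≤-trans (handshake-≤ {G = Grs k s} (adjG-symmetric k))
                                     (subst (degreeSum k ≤_) (double (suc k) (s ^ suc (suc k))) (degreeSum-≤ k)))
    where
    double : ∀ k X → 8 * k * X ≡ 2 * (4 * k * X)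
    double = solve-∀


  -- Matching and independent sets

  -- Only its values on A₁ matter: in every copy of K_{2s,2s} it sends left i to right i.
  mate : ∀ k → Fin (Nv s k) → Fin (Nv s k)
  mate zero u = right (reduce (splitAt (2 * s) u))
  mate (suc k) u = [ (λ c → uncurry (λ p a → copy k p (mate k a)) (remQuot {s} (Nv s k) c)) , apex k ]′ (splitAt (s * Nv s k) u)

  mate-left : ∀ i → mate zero (left i) ≡ right i
  mate-left i rewrite splitAt-↑ˡ (2 * s) i (2 * s) = refl

  mate-copy : ∀ k p a → mate (suc k) (copy k p a) ≡ copy k p (mate k a)
  mate-copy k p a rewrite splitAt-↑ˡ (s * Nv s k) (combine p a) s | quotRem-combine {k} p a = refl

  private
    apex∉A₁ : ∀ {k} x → clsG s (suc k) (apex k x) ≢ zero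
    apex∉A₁ {k} x eq = contradiction (trans (sym (clsG-apex x)) eq) λ ()

    copy-A₁ : ∀ {k} p a → clsG s (suc k) (copy k p a) ≡ zero → clsG s k a ≡ zero
    copy-A₁ p a eq = inject₁-injective (trans (sym (clsG-copy p a)) eq)

  mate-matches : ∀ k v → clsG s k v ≡ zero → clsG s k (mate k v) ≡ suc zero × adjG s k v (mate k v) ≡ true
  mate-matches zero v v∈A₁ with baseView v
  ... | on-left i rewrite mate-left i = clsG-right i , adjG-left-right i i
  ... | on-right i = contradiction (trans (sym v∈A₁) (clsG-right i)) λ ()
  mate-matches (suc k) v v∈A₁ with stepView k v
  ... | at-apex x = contradiction v∈A₁ (apex∉A₁ x)
  ... | in-copy p a with mate-matches k a (copy-A₁ p a v∈A₁)
  ...   | mate∈A₂ , a~mate rewrite mate-copy k p a =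
    trans (clsG-copy p (mate k a)) (cong inject₁ mate∈A₂) ,
    trans (adjG-copy-copy p a p (mate k a)) (cong₂ _∧_ (==-refl p) a~mate)

  mate-injective : ∀ k u v → clsG s k u ≡ zero → clsG s k v ≡ zero → mate k u ≡ mate k v → u ≡ v
  mate-injective zero u v u∈A₁ v∈A₁ eq with baseView u | baseView v
  ... | on-left i | on-left j rewrite mate-left i | mate-left j = cong left (↑ʳ-injective (2 * s) i j eq)
  ... | on-right i | _ = contradiction (trans (sym u∈A₁) (clsG-right i)) λ ()
  ... | on-left i | on-right j = contradiction (trans (sym v∈A₁) (clsG-right j)) λ ()
  mate-injective (suc k) u v u∈A₁ v∈A₁ eq with stepView k u | stepView k v
  ... | at-apex x | _ = contradiction u∈A₁ (apex∉A₁ x)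
  ... | in-copy p a | at-apex x = contradiction v∈A₁ (apex∉A₁ x)
  ... | in-copy p a | in-copy q b rewrite mate-copy k p a | mate-copy k q b with copy-injective {k} eq
  ...   | refl , mates≡ = cong (copy k p) (mate-injective k a b (copy-A₁ p a u∈A₁) (copy-A₁ p b v∈A₁) mates≡)

  independent-≤ : ∀ k (S : Fin (Nv s k) → Bool) → (∀ x y → S x ≡ true → S y ≡ true → adjG s k x y ≡ false) →
                  countF S ≤ sumPow s k + 2 * s ^ suc k
  independent-≤ zero S independent = begin
    countF S                                 ≡⟨ countF-base S ⟩
    countF (S ∘ left) + countF (S ∘ right)   ≤⟨ countF-disjoint-≤ {h = λ _ → true} not-both (λ _ _ → refl) ⟩
    countF {2 * s} (λ _ → true)              ≡⟨ countF-const (2 * s) true ⟩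
    2 * s                                    ≡⟨ cong (2 *_) (*-identityʳ s) ⟨
    sumPow s zero + 2 * s ^ 1                ∎
    where
    open ≤-Reasoning
    not-both : ∀ i → S (left i) ∧ S (right i) ≡ false
    not-both i with S (left i) in left∈S | S (right i) in right∈S
    ... | true | true = contradiction (trans (sym (adjG-left-right i i)) (independent _ _ left∈S right∈S)) λ ()
    ... | true | false = refl
    ... | false | _ = refl
  independent-≤ (suc k) S independent = begin
    countF S                                                        ≡⟨ countF-step k S ⟩
    sumF (λ p → countF (S ∘ copy k p)) + countF (S ∘ apex k)
      ≤⟨ +-mono-≤ (sumF-mono λ p → independent-≤ k (S ∘ copy k p) (in-copy-independent p)) (countF-≤ (S ∘ apex k)) ⟩
    sumF {s} (λ _ → sumPow s k + 2 * s ^ suc k) + s                 ≡⟨ cong (_+ s) (sumF-const s _) ⟩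
    s * (sumPow s k + 2 * s ^ suc k) + s                            ≡⟨ regroup s (sumPow s k) (s ^ suc k) ⟩
    (s * sumPow s k + s) + 2 * s ^ suc (suc k)                      ≡⟨ cong (_+ 2 * s ^ suc (suc k)) (sumPow-suc s k) ⟩
    sumPow s (suc k) + 2 * s ^ suc (suc k)                          ∎
    where
    open ≤-Reasoning
    in-copy-independent : ∀ p x y → S (copy k p x) ≡ true → S (copy k p y) ≡ true → adjG s k x y ≡ false
    in-copy-independent p x y x∈S y∈S =
      trans (sym (cong (_∧ adjG s k x y) (==-refl p))) (trans (sym (adjG-copy-copy p x p y)) (independent _ _ x∈S y∈S))
    regroup : ∀ s P X → s * (P + 2 * X) + s ≡ (s * P + s) + 2 * (s * X)
    regroup = solve-∀

  independent-subset-≤ : ∀ k (S : Subset (Nv s k)) → (∀ u v → u ∈ S → v ∈ S → adjG s k u v ≡ false) →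
                         ∣ S ∣ ≤ Nv s k ∸ 2 * s ^ suc k
  independent-subset-≤ k S independent = begin
    ∣ S ∣                                  ≡⟨ ∣p∣≡countF-lookup S ⟩
    countF (Vec.lookup S)
      ≤⟨ independent-≤ k (Vec.lookup S) (λ u v u∈S v∈S → independent u v (lookup⇒[]= u S u∈S) (lookup⇒[]= v S v∈S)) ⟩
    sumPow s k + 2 * X                     ≡⟨ m+n∸n≡m (sumPow s k + 2 * X) (2 * X) ⟨
    sumPow s k + 2 * X + 2 * X ∸ 2 * X     ≡⟨ cong (_∸ 2 * X) (trans (+-assoc (sumPow s k) (2 * X) (2 * X)) (cong (sumPow s k +_) (double X))) ⟩
    sumPow s k + 4 * X ∸ 2 * X             ≡⟨ cong (_∸ 2 * X) (Nv≡sumPow+4s^[k+1] s k) ⟨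
    Nv s k ∸ 2 * X                         ∎
    where
    open ≤-Reasoning
    X = s ^ suc k
    double : ∀ X → 2 * X + 2 * X ≡ 4 * X
    double = solve-∀

proposition1 : (k s : ℕ) → 2 ≤ s →
  let r = suc (suc k)
      G = Grs k s
      H = pComplement G
  in
  (∀ u v → adj G u v ≡ true → cls G u ≢ cls G v)
  × (¬ KCopy r H)
  × (∀ (i : Fin r) → KCopyAvoiding (suc k) H i)
  × (∀ u v → adj G u v ≡ true → cls G u ≢ cls G v → KCopy r (addEdge H u v))
  × (n G ≡ sumPow s k + 4 * s ^ suc k)
  × ((s ∸ 1) * n G ≡ s * (4 * s ^ suc k ∸ 3 * s ^ k ∸ 1))
  × ((s ∸ 1) * n G ≤ 4 * s ^ r)
  × (edges G ≤ 4 * suc k * s ^ r)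
  × (classSize G zero ≡ 2 * s ^ suc k)
  × (classSize G (suc zero) ≡ 2 * s ^ suc k)
  × (∀ (i : Fin r) → 2 ≤ toℕ i → classSize G i ≤ s ^ k)
  × (Σ (Fin (n G) → Fin (n G)) λ m →
       (∀ v → cls G v ≡ zero → (cls G (m v) ≡ suc zero) × (adj G v (m v) ≡ true))
       × (∀ u v → cls G u ≡ zero → cls G v ≡ zero → m u ≡ m v → u ≡ v))
  × (∀ (S : Subset (n G)) →
       (∀ u v → u ∈ S → v ∈ S → adj G u v ≡ false) →
       ∣ S ∣ ≤ n G ∸ 2 * s ^ suc k)
proposition1 k s@(suc (suc _)) (s≤s (s≤s z≤n)) =
  adjG-partite s k ,
  Gᶜ-Kᵣ-free s k ,
  Gᶜ-Kᵣ₋₁-avoiding s {zero} {suc zero} (λ ()) k ,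
  Gᶜ-saturating s k ,
  Nv≡sumPow+4s^[k+1] s k ,
  pred*Nv≡s*[4s^[k+1]∸3s^k∸1] s k ,
  pred*Nv≤4s^[k+2] s k ,
  edges-≤ s k ,
  classSize-A₁A₂ s k zero ,
  classSize-A₁A₂ s k (suc zero) ,
  classSize-others s k ,
  (mate s k , mate-matches s k , mate-injective s k) ,
  independent-subset-≤ s k
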